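{- Let $G$ be a triangle-free graph with $m$ edges and let $k\ge 0$ be an integer. Let $G'$ be obtained from $G$ by subdividing each edge $e=xy$ of $G$ with three new vertices $e_x,e_{xy},e_y$, i.e. replacing $e$ by the path $x\,e_x\,e_{xy}\,e_y\,y$ in which all new vertices have degree $2$. Then $G$ has a cluster vertex deletion set of size at most $k$ if and only if $G'$ has a cluster vertex deletion set of size at most $k+m$.
   Context: Graphs are finite, simple, undirected. A set $S\subseteq V(G)$ is a cluster vertex deletion set of $G$ if $G-S$ is a cluster graph, i.e. every connected component of $G-S$ is a clique (equivalently $G-S$ has no induced $P_3$). -}

module Defs where

open import Data.Nat using (ℕ; _≤_; _+_)
open import Data.Fin using (Fin; zero; suc)
open import Data.Product using (_×_; _,_; proj₁; proj₂; ∃; Σ; swap)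
open import Data.Sum using (_⊎_; inj₁; inj₂)
open import Data.Empty using (⊥)
open import Data.List using (List; length)
open import Data.List.Membership.Propositional using (_∉_)
open import Relation.Binary.PropositionalEquality using (_≡_; _≢_)

-- A finite simple graph on vertex set Fin n with m edges, given by an
-- injective enumeration of its edges  es : Fin m → Fin n × Fin n
-- (each unordered edge {x,y} listed exactly once, in some orientation).
record SimpleGraph (n m : ℕ) : Set where
  field
    es       : Fin m → Fin n × Fin n
    noLoop   : ∀ i → proj₁ (es i) ≢ proj₂ (es i)
    distinct : ∀ i j → i ≢ j → (es i ≢ es j) × (es i ≢ swap (es j))

module _ {n m : ℕ} (G : SimpleGraph n m) where
  open SimpleGraph G

  Adj : Fin n → Fin n → Set
  Adj x y = Σ (Fin m) λ i → (es i ≡ (x , y)) ⊎ (es i ≡ (y , x))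

  TriangleFree : Set
  TriangleFree = ∀ x y z → Adj x y → Adj y z → Adj x z → ⊥

  -- Vertices of the subdivided graph G': old vertices, and for each edge
  -- i with es i = (x , y) three new vertices (i , 0) = e_x,
  -- (i , 1) = e_xy, (i , 2) = e_y.
  SubV : Set
  SubV = Fin n ⊎ (Fin m × Fin 3)

  data Arc : SubV → SubV → Set where
    arc-x  : ∀ i → Arc (inj₁ (proj₁ (es i))) (inj₂ (i , zero))
    arc-xy : ∀ i → Arc (inj₂ (i , zero)) (inj₂ (i , suc zero))
    arc-yx : ∀ i → Arc (inj₂ (i , suc zero)) (inj₂ (i , suc (suc zero)))
    arc-y  : ∀ i → Arc (inj₂ (i , suc (suc zero))) (inj₁ (proj₂ (es i)))

  SubAdj : SubV → SubV → Set
  SubAdj u v = Arc u v ⊎ Arc v u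

-- S (a list of vertices; its length bounds the size of the set it denotes)
-- is a cluster vertex deletion set for the graph with adjacency Adj:
-- G - S has no induced P3.
IsCVD : {V : Set} → (V → V → Set) → List V → Set
IsCVD {V} E S = ∀ u v w → u ∉ S → v ∉ S → w ∉ S →
  E u v → E v w → u ≢ w → E u w

HasCVD : {V : Set} → (V → V → Set) → ℕ → Set
HasCVD {V} E k = ∃ λ (S : List V) → (length S ≤ k) × IsCVD E S

-- For triangle-free G, a cluster deletion set S is exactly a set leaving G − S of maximum
-- degree at most one, since a triangle-free cluster graph is a matching.
-- Forward: add to S one vertex of every path x e_x e_xy e_y y, namely e_x if x survives and
-- y is deleted, symmetrically e_y, and e_xy otherwise; G′ − S′ again has maximum degree one.
-- Backward: every such path meets S′, or e_x e_xy e_y is an induced P₃. Charge one hit of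
-- each edge to the m extra deletions and replace every further hit by an endpoint of the
-- edge, so |S| + m ≤ |S′|. An edge of G − S is then hit exactly once, at its middle vertex,
-- so if y had two neighbours in G − S, the subdivision vertices next to y on these two edges
-- would form an induced P₃ through y in G′ − S′.
module Submission where

open import Defs
open import Data.Nat using (ℕ; _+_)
open import Function.Bundles using (_⇔_; mk⇔)

open import Function.Base using (_∘_)
open import Data.Nat using (suc; _≤_; _≤?_)
open import Data.Nat.Properties using (+-suc; +-cancelʳ-≤; +-monoʳ-≤; +-monoˡ-≤; ≤-trans; ≤-reflexive; ≰⇒>; module ≤-Reasoning)
open import Data.Fin using (Fin; zero; suc; _≟_)
open import Data.Fin.Properties using (pigeonhole; <⇒≢)
open import Data.Bool using (Bool; true; false; not)
open import Data.Maybe using (Maybe; just; nothing; maybe)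
open import Data.Product using (_×_; _,_; proj₁; proj₂; ∃; ∃₂; swap)
open import Data.Sum using (_⊎_; inj₁; inj₂)
import Data.Sum as Sum
import Data.Sum.Properties as ⊎
import Data.Product.Properties as ×
open import Data.List using (List; []; _∷_; length; map; _++_; tabulate; lookup; partitionSumsWith)
open import Data.List.Properties using (length-++; length-map; length-tabulate)
open import Data.List.Membership.Propositional using (_∈_; _∉_)
open import Data.List.Membership.Propositional.Properties using (∈-map⁺; ∈-++⁺ˡ; ∈-++⁺ʳ; ∈-tabulate⁺)
import Data.List.Membership.DecPropositional as DecMembership
open import Data.List.Relation.Unary.Any using (here; there; index)
open import Data.List.Relation.Unary.Any.Properties using (lookup-index)
open import Data.Empty using (⊥; ⊥-elim)
open import Relation.Nullary using (¬_; yes; no; contradiction)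
open import Relation.Binary.Definitions using (DecidableEquality)
open import Relation.Binary.PropositionalEquality using (_≡_; _≢_; refl; sym; trans; cong; cong₂; subst)

module _ {A B C : Set} (f : A → B ⊎ C) where

  length-partitionSumsWith : ∀ xs → let (ys , zs) = partitionSumsWith f xs in
                             length ys + length zs ≡ length xs
  length-partitionSumsWith []       = refl
  length-partitionSumsWith (x ∷ xs) with f x
  ... | inj₁ _ = cong suc (length-partitionSumsWith xs)
  ... | inj₂ _ = trans (+-suc _ _) (cong suc (length-partitionSumsWith xs))

  ∈-partitionSumsWith-inj₁ : ∀ {x y} xs → x ∈ xs → f x ≡ inj₁ y →
                             y ∈ proj₁ (partitionSumsWith f xs)
  ∈-partitionSumsWith-inj₁ (x ∷ xs) (here refl) fx≡y rewrite fx≡y = here refl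
  ∈-partitionSumsWith-inj₁ (z ∷ xs) (there x∈xs) fx≡y with f z
  ... | inj₁ _ = there (∈-partitionSumsWith-inj₁ xs x∈xs fx≡y)
  ... | inj₂ _ = ∈-partitionSumsWith-inj₁ xs x∈xs fx≡y

  ∈-partitionSumsWith-inj₂ : ∀ {x z} xs → x ∈ xs → f x ≡ inj₂ z →
                             z ∈ proj₂ (partitionSumsWith f xs)
  ∈-partitionSumsWith-inj₂ (x ∷ xs) (here refl) fx≡z rewrite fx≡z = here refl
  ∈-partitionSumsWith-inj₂ (y ∷ xs) (there x∈xs) fx≡z with f y
  ... | inj₁ _ = ∈-partitionSumsWith-inj₂ xs x∈xs fx≡z
  ... | inj₂ _ = there (∈-partitionSumsWith-inj₂ xs x∈xs fx≡z)

cover⇒n≤length : ∀ {n} (xs : List (Fin n)) → (∀ i → i ∈ xs) → n ≤ length xs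
cover⇒n≤length {n} xs cover with n ≤? length xs
... | yes n≤len = n≤len
... | no n≰len with pigeonhole (≰⇒> n≰len) (λ i → index (cover i))
...   | i , j , i<j , same-index =
  contradiction (trans (lookup-index (cover i)) (trans (cong (lookup xs) same-index) (sym (lookup-index (cover j))))) (<⇒≢ i<j)

DegreeAtMostOne : {V : Set} → (V → V → Set) → List V → Set
DegreeAtMostOne E S = ∀ {u v w} → u ∉ S → v ∉ S → w ∉ S → E v u → E v w → u ≡ w

degreeAtMostOne⇒IsCVD : {V : Set} {E : V → V → Set} {S : List V} →
                        (∀ {u v} → E u v → E v u) → DegreeAtMostOne E S → IsCVD E S
degreeAtMostOne⇒IsCVD sym-E deg u v w u∉S v∉S w∉S uv vw u≢w = contradiction (deg u∉S v∉S w∉S (sym-E uv) vw) u≢w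

module Subdivision {n m : ℕ} (G : SimpleGraph n m) where
  open SimpleGraph G

  endpoint : Fin m → Bool → Fin n
  endpoint i true  = proj₁ (es i)
  endpoint i false = proj₂ (es i)

  other : Fin m → Bool → Fin n
  other i s = endpoint i (not s)

  sub : Fin m → Bool → SubV G
  sub i true  = inj₂ (i , zero)
  sub i false = inj₂ (i , suc (suc zero))

  mid : Fin m → SubV G
  mid i = inj₂ (i , suc zero)

  endpoint-adj : ∀ i s → Adj G (endpoint i s) (other i s)
  endpoint-adj i true  = i , inj₁ refl
  endpoint-adj i false = i , inj₂ refl

  adj-view : ∀ {x y} → Adj G x y → ∃₂ λ i s → endpoint i s ≡ x × other i s ≡ y
  adj-view (i , inj₁ es≡xy) = i , true  , cong proj₁ es≡xy , cong proj₂ es≡xy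
  adj-view (i , inj₂ es≡yx) = i , false , cong proj₂ es≡yx , cong proj₁ es≡yx

  adj-sym : ∀ {x y} → Adj G x y → Adj G y x
  adj-sym (i , e) = i , Sum.swap e

  endpoint-injective : ∀ i s t → endpoint i s ≡ endpoint i t → s ≡ t
  endpoint-injective i true  true  _ = refl
  endpoint-injective i true  false e = contradiction e (noLoop i)
  endpoint-injective i false true  e = contradiction (sym e) (noLoop i)
  endpoint-injective i false false _ = refl

  edge-determined : ∀ i j s t → endpoint i s ≡ endpoint j t → other i s ≡ other j t → i ≡ j
  edge-determined i j s t e o with i ≟ j
  ... | yes i≡j = i≡j
  ... | no i≢j = contradiction (cong₂ _,_ e o) (same-or-swapped s t (distinct i j i≢j))
    where
    same-or-swapped : ∀ s t → (es i ≢ es j) × (es i ≢ swap (es j)) →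
                      (endpoint i s , other i s) ≢ (endpoint j t , other j t)
    same-or-swapped true  true  (≢ , _) eq = ≢ eq
    same-or-swapped true  false (_ , ≢) eq = ≢ eq
    same-or-swapped false true  (_ , ≢) eq = ≢ (cong swap eq)
    same-or-swapped false false (≢ , _) eq = ≢ (cong swap eq)

  sub-determined : ∀ i j s t → endpoint i s ≡ endpoint j t → other i s ≡ other j t → sub i s ≡ sub j t
  sub-determined i j s t e o with edge-determined i j s t e o
  ... | refl with endpoint-injective i s t e
  ...   | refl = refl

  sub-injective : ∀ i j s t → sub i s ≡ sub j t → i ≡ j × s ≡ t
  sub-injective i .i true  true  refl = refl , refl
  sub-injective i .i false false refl = refl , refl

  sub-adj-endpoint : ∀ i s → SubAdj G (sub i s) (inj₁ (endpoint i s))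
  sub-adj-endpoint i true  = inj₂ (arc-x i)
  sub-adj-endpoint i false = inj₁ (arc-y i)

  mid-adj-sub : ∀ i s → SubAdj G (mid i) (sub i s)
  mid-adj-sub i true  = inj₂ (arc-xy i)
  mid-adj-sub i false = inj₁ (arc-yx i)

  sub-adj-mid : ∀ i s → SubAdj G (sub i s) (mid i)
  sub-adj-mid i s = Sum.swap (mid-adj-sub i s)

  sub-nonadj-sub : ∀ i j s t → ¬ SubAdj G (sub i s) (sub j t)
  sub-nonadj-sub i j true  true  = λ { (inj₁ ()) ; (inj₂ ()) }
  sub-nonadj-sub i j true  false = λ { (inj₁ ()) ; (inj₂ ()) }
  sub-nonadj-sub i j false true  = λ { (inj₁ ()) ; (inj₂ ()) }
  sub-nonadj-sub i j false false = λ { (inj₁ ()) ; (inj₂ ()) }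

  mid-nonadj-old : ∀ i x → ¬ SubAdj G (mid i) (inj₁ x)
  mid-nonadj-old i x (inj₁ ())
  mid-nonadj-old i x (inj₂ ())

  old-neighbour : ∀ {x u} → SubAdj G (inj₁ x) u → ∃₂ λ i s → endpoint i s ≡ x × u ≡ sub i s
  old-neighbour (inj₁ (arc-x i)) = i , true  , refl , refl
  old-neighbour (inj₂ (arc-y i)) = i , false , refl , refl

  sub-neighbour : ∀ {i u} s → SubAdj G (sub i s) u → u ≡ inj₁ (endpoint i s) ⊎ u ≡ mid i
  sub-neighbour true  (inj₁ (arc-xy _)) = inj₂ refl
  sub-neighbour true  (inj₂ (arc-x _))  = inj₁ refl
  sub-neighbour false (inj₁ (arc-y _))  = inj₁ refl
  sub-neighbour false (inj₂ (arc-yx _)) = inj₂ refl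

  mid-neighbour : ∀ {i u} → SubAdj G (mid i) u → ∃ λ s → u ≡ sub i s
  mid-neighbour (inj₁ (arc-yx _)) = false , refl
  mid-neighbour (inj₂ (arc-xy _)) = true  , refl

  triangleFree∧IsCVD⇒degreeAtMostOne : ∀ {S} → TriangleFree G → IsCVD (Adj G) S → DegreeAtMostOne (Adj G) S
  triangleFree∧IsCVD⇒degreeAtMostOne tf cvd {u} {v} {w} u∉S v∉S w∉S vu vw with u ≟ w
  ... | yes u≡w = u≡w
  ... | no u≢w = ⊥-elim (tf v u w vu (cvd u v w u∉S v∉S w∉S (adj-sym vu) vw u≢w) vw)

  module Forward (S : List (Fin n)) (deg : DegreeAtMostOne (Adj G) S) where
    open DecMembership (_≟_ {n}) using (_∈?_)

    cut : Fin m → Maybe Bool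
    cut i with endpoint i true ∈? S | endpoint i false ∈? S
    ... | no _  | yes _ = just true
    ... | yes _ | no _  = just false
    ... | _     | _     = nothing

    cut-just : ∀ i s → cut i ≡ just s → other i s ∈ S
    cut-just i s eq with endpoint i true ∈? S | endpoint i false ∈? S
    cut-just i true  refl | no _    | yes y∈S = y∈S
    cut-just i false refl | yes x∈S | no _    = x∈S
    cut-just i s     ()   | yes _   | yes _
    cut-just i s     ()   | no _    | no _

    cut-when : ∀ i s → endpoint i s ∉ S → other i s ∈ S → cut i ≡ just s
    cut-when i s e∉S o∈S with endpoint i true ∈? S | endpoint i false ∈? S
    cut-when i true  e∉S o∈S | no _    | yes _   = refl
    cut-when i false e∉S o∈S | yes _   | no _    = refl
    cut-when i true  e∉S o∈S | yes x∈S | _       = contradiction x∈S e∉S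
    cut-when i true  e∉S o∈S | no _    | no y∉S  = contradiction o∈S y∉S
    cut-when i false e∉S o∈S | _       | yes y∈S = contradiction y∈S e∉S
    cut-when i false e∉S o∈S | no x∉S  | no _    = contradiction o∈S x∉S

    cut-vertex : Fin m → SubV G
    cut-vertex i = maybe (sub i) (mid i) (cut i)

    S′ : List (SubV G)
    S′ = map inj₁ S ++ tabulate cut-vertex

    length-S′ : length S′ ≡ length S + m
    length-S′ = trans (length-++ (map inj₁ S)) (cong₂ _+_ (length-map inj₁ S) (length-tabulate cut-vertex))

    old∉S′⇒∉S : ∀ {x} → inj₁ x ∉ S′ → x ∉ S
    old∉S′⇒∉S x∉S′ x∈S = x∉S′ (∈-++⁺ˡ (∈-map⁺ inj₁ x∈S))

    cut-deleted : ∀ i {c} → cut i ≡ c → maybe (sub i) (mid i) c ∈ S′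
    cut-deleted i refl = ∈-++⁺ʳ (map inj₁ S) (∈-tabulate⁺ i)

    other∉S : ∀ i s → sub i s ∉ S′ → endpoint i s ∉ S → other i s ∉ S
    other∉S i s sub∉S′ e∉S o∈S = sub∉S′ (cut-deleted i (cut-when i s e∉S o∈S))

    endpoint∈S : ∀ i s → sub i s ∉ S′ → mid i ∉ S′ → endpoint i s ∈ S
    endpoint∈S i s sub∉S′ mid∉S′ with cut i in eq
    endpoint∈S i s     sub∉S′ mid∉S′ | nothing    = contradiction (cut-deleted i eq) mid∉S′
    endpoint∈S i true  sub∉S′ mid∉S′ | just true  = contradiction (cut-deleted i eq) sub∉S′
    endpoint∈S i true  sub∉S′ mid∉S′ | just false = cut-just i false eq
    endpoint∈S i false sub∉S′ mid∉S′ | just true  = cut-just i true eq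
    endpoint∈S i false sub∉S′ mid∉S′ | just false = contradiction (cut-deleted i eq) sub∉S′

    edge-hit : ∀ i → sub i true ∉ S′ → sub i false ∉ S′ → mid i ∉ S′ → ⊥
    edge-hit i x∉S′ y∉S′ mid∉S′ with cut i in eq
    ... | nothing    = mid∉S′ (cut-deleted i eq)
    ... | just true  = x∉S′ (cut-deleted i eq)
    ... | just false = y∉S′ (cut-deleted i eq)

    sub-degree : ∀ i s {u w} → u ∉ S′ → sub i s ∉ S′ → w ∉ S′ →
                 SubAdj G (sub i s) u → SubAdj G (sub i s) w → u ≡ w
    sub-degree i s u∉S′ v∉S′ w∉S′ vu vw with sub-neighbour s vu | sub-neighbour s vw
    ... | inj₁ refl | inj₁ refl = refl
    ... | inj₂ refl | inj₂ refl = refl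
    ... | inj₁ refl | inj₂ refl = contradiction (endpoint∈S i s v∉S′ w∉S′) (old∉S′⇒∉S u∉S′)
    ... | inj₂ refl | inj₁ refl = contradiction (endpoint∈S i s v∉S′ u∉S′) (old∉S′⇒∉S w∉S′)

    mid-degree : ∀ i {u w} → u ∉ S′ → mid i ∉ S′ → w ∉ S′ →
                 SubAdj G (mid i) u → SubAdj G (mid i) w → u ≡ w
    mid-degree i u∉S′ v∉S′ w∉S′ vu vw with mid-neighbour vu | mid-neighbour vw
    ... | true  , refl | true  , refl = refl
    ... | false , refl | false , refl = refl
    ... | true  , refl | false , refl = ⊥-elim (edge-hit i u∉S′ w∉S′ v∉S′)
    ... | false , refl | true  , refl = ⊥-elim (edge-hit i w∉S′ u∉S′ v∉S′)

    old-degree : ∀ x {u w} → u ∉ S′ → inj₁ x ∉ S′ → w ∉ S′ →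
                 SubAdj G (inj₁ x) u → SubAdj G (inj₁ x) w → u ≡ w
    old-degree x u∉S′ v∉S′ w∉S′ vu vw with old-neighbour vu | old-neighbour vw
    ... | i , s , refl , refl | j , t , e , refl =
      sub-determined i j s t (sym e) (deg (other∉S i s u∉S′ x∉S) x∉S (other∉S j t w∉S′ e∉S)
                                          (endpoint-adj i s) (subst (λ y → Adj G y (other j t)) e (endpoint-adj j t)))
      where
      x∉S : endpoint i s ∉ S
      x∉S = old∉S′⇒∉S v∉S′
      e∉S : endpoint j t ∉ S
      e∉S = subst (_∉ S) (sym e) x∉S

    degree-S′ : DegreeAtMostOne (SubAdj G) S′
    degree-S′ {v = inj₁ x}                    = old-degree x
    degree-S′ {v = inj₂ (i , zero)}           = sub-degree i true
    degree-S′ {v = inj₂ (i , suc zero)}       = mid-degree i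
    degree-S′ {v = inj₂ (i , suc (suc zero))} = sub-degree i false

  module Backward (S′ : List (SubV G)) (cvd′ : IsCVD (SubAdj G) S′) where
    _≟V_ : DecidableEquality (SubV G)
    _≟V_ = ⊎.≡-dec _≟_ (×.≡-dec _≟_ _≟_)

    open DecMembership _≟V_ using (_∈?_)

    designated : Fin m → Fin 3
    designated i with sub i true ∈? S′ | mid i ∈? S′
    ... | yes _ | _     = zero
    ... | no _  | yes _ = suc zero
    ... | no _  | no _  = suc (suc zero)

    designated∈S′ : ∀ i → inj₂ (i , designated i) ∈ S′
    designated∈S′ i with sub i true ∈? S′ | mid i ∈? S′ | sub i false ∈? S′
    ... | yes x∈S′ | _        | _        = x∈S′
    ... | no _     | yes m∈S′ | _        = m∈S′
    ... | no _     | no _     | yes y∈S′ = y∈S′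
    ... | no x∉S′  | no m∉S′  | no y∉S′  = ⊥-elim (sub-nonadj-sub i i true false
      (cvd′ _ _ _ x∉S′ m∉S′ y∉S′ (sub-adj-mid i true) (mid-adj-sub i false) λ ()))

    classify : SubV G → Fin n ⊎ Fin m
    classify (inj₁ x) = inj₁ x
    classify (inj₂ (i , t)) with t ≟ designated i
    ... | yes _ = inj₂ i
    ... | no _  = inj₁ (endpoint i true)

    S : List (Fin n)
    S = proj₁ (partitionSumsWith classify S′)

    designated-edges : List (Fin m)
    designated-edges = proj₂ (partitionSumsWith classify S′)

    old∈S : ∀ {x} → inj₁ x ∈ S′ → x ∈ S
    old∈S x∈S′ = ∈-partitionSumsWith-inj₁ classify S′ x∈S′ refl

    extra-hit : ∀ i t → inj₂ (i , t) ∈ S′ → t ≢ designated i → endpoint i true ∈ S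
    extra-hit i t t∈S′ t≢d = ∈-partitionSumsWith-inj₁ classify S′ t∈S′ classify≡
      where
      classify≡ : classify (inj₂ (i , t)) ≡ inj₁ (endpoint i true)
      classify≡ with t ≟ designated i
      ... | yes t≡d = contradiction t≡d t≢d
      ... | no _    = refl

    designated-edges-cover : ∀ i → i ∈ designated-edges
    designated-edges-cover i = ∈-partitionSumsWith-inj₂ classify S′ (designated∈S′ i) classify≡
      where
      classify≡ : classify (inj₂ (i , designated i)) ≡ inj₂ i
      classify≡ with designated i ≟ designated i
      ... | yes _ = refl
      ... | no d≢d = contradiction refl d≢d

    length-S : ∀ {k} → length S′ ≤ k + m → length S ≤ k
    length-S {k} len = +-cancelʳ-≤ m (length S) k (begin
      length S + m                       ≤⟨ +-monoʳ-≤ (length S) (cover⇒n≤length designated-edges designated-edges-cover) ⟩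
      length S + length designated-edges ≡⟨ length-partitionSumsWith classify S′ ⟩
      length S′                          ≤⟨ len ⟩
      k + m                              ∎)
      where open ≤-Reasoning

    ∉S⇒old∉S′ : ∀ {x} → x ∉ S → inj₁ x ∉ S′
    ∉S⇒old∉S′ x∉S x∈S′ = x∉S (old∈S x∈S′)

    hit-once : ∀ i {t t′} → endpoint i true ∉ S → inj₂ (i , t) ∈ S′ → inj₂ (i , t′) ∈ S′ → t ≡ t′
    hit-once i {t} {t′} x∉S t∈S′ t′∈S′ with t ≟ designated i | t′ ≟ designated i
    ... | yes t≡d | yes t′≡d = trans t≡d (sym t′≡d)
    ... | no t≢d  | _        = contradiction (extra-hit i t t∈S′ t≢d) x∉S
    ... | _       | no t′≢d  = contradiction (extra-hit i t′ t′∈S′ t′≢d) x∉S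

    only-sub-hit : ∀ i s → endpoint i true ∉ S → sub i s ∈ S′ → mid i ∉ S′ × sub i (not s) ∉ S′
    only-sub-hit i true  x∉S sub∈S′ = (λ ()) ∘ hit-once i x∉S sub∈S′ , (λ ()) ∘ hit-once i x∉S sub∈S′
    only-sub-hit i false x∉S sub∈S′ = (λ ()) ∘ hit-once i x∉S sub∈S′ , (λ ()) ∘ hit-once i x∉S sub∈S′

    first-endpoint∉S : ∀ i s → endpoint i s ∉ S → other i s ∉ S → endpoint i true ∉ S
    first-endpoint∉S i true  e∉S _   = e∉S
    first-endpoint∉S i false _   o∉S = o∉S

    sub∉S′ : ∀ i s → endpoint i s ∉ S → other i s ∉ S → sub i s ∉ S′
    sub∉S′ i s e∉S o∉S sub∈S′ =
      mid-nonadj-old i (other i s)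
        (cvd′ _ _ _ mid∉S′ far∉S′ (∉S⇒old∉S′ o∉S) (mid-adj-sub i (not s)) (sub-adj-endpoint i (not s)) λ ())
      where
      mid∉S′ : mid i ∉ S′
      mid∉S′ = proj₁ (only-sub-hit i s (first-endpoint∉S i s e∉S o∉S) sub∈S′)
      far∉S′ : sub i (not s) ∉ S′
      far∉S′ = proj₂ (only-sub-hit i s (first-endpoint∉S i s e∉S o∉S) sub∈S′)

    degree-S : DegreeAtMostOne (Adj G) S
    degree-S x∉S y∉S z∉S yx yz with adj-view yx | adj-view yz
    ... | i , s , refl , refl | j , t , e , refl with sub i s ≟V sub j t
    ...   | yes same with sub-injective i j s t same
    ...     | refl , refl = refl
    degree-S x∉S y∉S z∉S yx yz | i , s , refl , refl | j , t , e , refl | no different =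
      ⊥-elim (sub-nonadj-sub i j s t (cvd′ _ _ _ (sub∉S′ i s y∉S x∉S) (∉S⇒old∉S′ y∉S) (sub∉S′ j t e∉S z∉S)
                                          (sub-adj-endpoint i s) (Sum.swap (subst (SubAdj G (sub j t) ∘ inj₁) e (sub-adj-endpoint j t)))
                                          different))
      where
      e∉S : endpoint j t ∉ S
      e∉S = subst (_∉ S) (sym e) y∉S

lemma11 : ∀ {n m : ℕ} (G : SimpleGraph n m) → TriangleFree G → (k : ℕ) →
    HasCVD (Adj G) k ⇔ HasCVD (SubAdj G) (k + m)
lemma11 {m = m} G tf k = mk⇔ forward backward
  where
  open Subdivision G

  forward : HasCVD (Adj G) k → HasCVD (SubAdj G) (k + m)
  forward (S , |S|≤k , cvd) =
    S′ , ≤-trans (≤-reflexive length-S′) (+-monoˡ-≤ m |S|≤k) , degreeAtMostOne⇒IsCVD Sum.swap degree-S′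
    where open Forward S (triangleFree∧IsCVD⇒degreeAtMostOne tf cvd)

  backward : HasCVD (SubAdj G) (k + m) → HasCVD (Adj G) k
  backward (S′ , |S′|≤k+m , cvd′) = S , length-S |S′|≤k+m , degreeAtMostOne⇒IsCVD adj-sym degree-S
    where open Backward S′ cvd′
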